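{- Let $m\in\mathbb{N}$ and let $B$ be the $r$-partite bottle graph with neck $\sigma$ and width $\omega$, where $\sigma<\omega$ are positive integers, and let $b:=|B|$. Let $B'$ be the complete $r$-partite graph with one vertex class of size $\sigma$ and $r-1$ vertex classes of size $\omega-1$ (the $r$-partite bottle graph with neck $\sigma$ and width $\omega-1$), let $B^*:=B(m)$ and $t:=(\omega-\sigma)b$. Then $B(mt)$, $B^*(mt)$, $B'(mt)$ and $K_r(mt)$ all have perfect $B^*$-tilings.
   Context: For positive integers $\sigma<\omega$, the $r$-partite bottle graph with neck $\sigma$ and width $\omega$ is the complete $r$-partite graph with one vertex class of size $\sigma$ and $r-1$ vertex classes of size $\omega$. For a graph $F$ and $t\in\mathbb{N}$, the blow-up $F(t)$ is obtained by replacing each vertex $x$ of $F$ by a set $V_x$ of $t$ independent vertices and each edge $xy$ by all edges between $V_x$ and $V_y$. A perfect $B^*$-tiling of a graph is a collection of vertex-disjoint copies of $B^*$ covering all its vertices. -}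

module Defs where

open import Data.Nat using (ℕ; zero; suc; _+_; _*_; _∸_)
open import Data.Fin using (Fin; zero; suc)
open import Data.Product using (Σ; _×_; _,_; proj₁; Σ-syntax)
open import Relation.Binary.PropositionalEquality using (_≡_; _≢_)
open import Function.Definitions using (Bijective)

record Graph : Set₁ where
  field
    V : Set
    E : V → V → Set
open Graph public

K : ℕ → Graph
K r = record { V = Fin r ; E = λ x y → x ≢ y }

completeMultipartite : (r : ℕ) → (Fin r → ℕ) → Graph
completeMultipartite r sizes = record
  { V = Σ[ i ∈ Fin r ] Fin (sizes i)
  ; E = λ x y → proj₁ x ≢ proj₁ y }

bottleSizes : (r σ ω : ℕ) → Fin r → ℕ
bottleSizes r σ ω zero    = σ
bottleSizes r σ ω (suc i) = ω

bottle : (r σ ω : ℕ) → Graph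
bottle r σ ω = completeMultipartite r (bottleSizes r σ ω)

bottleOrder : (r σ ω : ℕ) → ℕ
bottleOrder r σ ω = σ + (r ∸ 1) * ω

blowUp : Graph → ℕ → Graph
blowUp F t = record
  { V = V F × Fin t
  ; E = λ p q → E F (proj₁ p) (proj₁ q) }

-- A copy of H in G given by an edge-preserving map (injectivity is enforced
-- by the tiling below).
IsHom : (H G : Graph) → (V H → V G) → Set
IsHom H G f = ∀ x y → E H x y → E G (f x) (f y)

-- A perfect H-tiling of G: finitely many copies φ i (i : Fin k) of H in G,
-- such that the combined map (i , x) ↦ φ i x is a bijection onto V G,
-- i.e. the copies are vertex-disjoint (and each injective) and cover V G.
record PerfectTiling (H G : Graph) : Set where
  field
    k      : ℕ
    copy   : Fin k → V H → V G
    isHom  : ∀ i → IsHom H G (copy i)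
    bij    : Bijective _≡_ _≡_ (λ (p : Fin k × V H) → copy (proj₁ p) (Data.Product.proj₂ p))

HasPerfectTiling : Graph → Graph → Set
HasPerfectTiling H G = PerfectTiling H G

-- Write r = n + 1, ω = σ + d + 1, b = |B| and t = (ω - σ) b = (d + 1) b.
-- All graphs involved are complete r-partite graphs, and perfect tilings of
-- such graphs can be added class by class.  Two basic tilings suffice:
--   * B* = B(m) tiles itself, a complete r-partite graph with class sizes
--     (σ m, ω m, ..., ω m);
--   * a properly r-coloured graph on N vertices tiles K_r(N) by r copies,
--     copy i shifting every colour by i modulo r (used for B*, N = b m).
-- Then B(mt) = B*(t) and B*(mt) are tiled by their layers, B'(mt) has the
-- class sizes of (d b) copies of B* plus σ copies of K_r(b m), and K_r(mt)
-- those of (d + 1) copies of K_r(b m).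
module Submission where

open import Defs
open import Data.Nat using (ℕ; zero; suc; _+_; _*_; _∸_; _≤_; _<_; NonZero)
open import Data.Nat.Properties using (+-comm; +-assoc; +-suc; <⇒≤; m+[n∸m]≡n; m∸n+n≡m; m+n∸m≡n; m≤n⇒∃[o]m+o≡n)
open import Data.Nat.DivMod using (_%_; _mod_; %-distribˡ-+; m%n%n≡m%n; [m+n]%n≡m%n; m<n⇒m%n≡m; m%n<n)
open import Data.Nat.Tactic.RingSolver using (solve-∀)
open import Data.Fin using (Fin; zero; suc; toℕ; splitAt)
open import Data.Fin.Properties using (toℕ-injective; toℕ-fromℕ<; toℕ<n; +↔⊎; *↔×)
open import Data.Product using (Σ; _×_; _,_; proj₁; proj₂)
open import Data.Product.Algebra using (×-cong; ×-comm; ×-distribʳ-⊎; Σ-assoc)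
open import Data.Sum using (_⊎_; inj₁; inj₂)
open import Data.Sum.Algebra using (⊎-cong)
open import Level using (0ℓ)
open import Data.Empty using (⊥; ⊥-elim)
open import Function.Bundles using (Inverse; Bijection; _↔_; mk↔ₛ′)
open import Function.Construct.Composition using (_↔-∘_)
open import Function.Properties.Inverse using (↔-refl; ↔-sym; ↔⇒⤖)
open import Function.Related.TypeIsomorphisms using (Σ-distribˡ-⊎)
open import Relation.Binary.PropositionalEquality
open Inverse using (to; from; strictlyInverseˡ; strictlyInverseʳ)

private
  variable
    G G' H : Graph

-- A perfect H-tiling of G presented by an explicit bijection between
-- "copy index × vertex of H" and the vertices of G, each copy being a
-- homomorphism.  Inverses make tilings easy to compose.
record Tiling (H G : Graph) : Set where
  field
    copies : ℕ
    place  : (Fin copies × V H) ↔ V G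
    isHom  : ∀ i → IsHom H G (λ x → to place (i , x))

perfect : Tiling H G → PerfectTiling H G
perfect T = record
  { k     = copies
  ; copy  = λ i x → to place (i , x)
  ; isHom = isHom
  ; bij   = Bijection.bijective (↔⇒⤖ place) }
  where open Tiling T

record SpanningCopy (G G' : Graph) : Set where
  field
    relabel : V G ↔ V G'
    keepsEdges : IsHom G G' (to relabel)

retile : Tiling H G → SpanningCopy G G' → Tiling H G'
retile T S = record
  { copies = copies
  ; place  = relabel ↔-∘ place
  ; isHom  = λ i x y e → keepsEdges _ _ (isHom i x y e) }
  where
  open Tiling T
  open SpanningCopy S

singleTiling : SpanningCopy H G → Tiling H G
singleTiling {H} S = record
  { copies = 1
  ; place  = relabel ↔-∘ dropIndex
  ; isHom  = λ _ x y e → keepsEdges x y e }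
  where
  open SpanningCopy S
  dropIndex : (Fin 1 × V H) ↔ V H
  dropIndex = mk↔ₛ′ proj₂ (zero ,_) (λ _ → refl) (λ { (zero , _) → refl })

layerTiling : ∀ H s → Tiling H (blowUp H s)
layerTiling H s = record
  { copies = s
  ; place  = ×-comm (Fin s) (V H)
  ; isHom  = λ _ x y e → e }

emptyTiling : (V G → ⊥) → Tiling H G
emptyTiling noVertex = record
  { copies = 0
  ; place  = mk↔ₛ′ (λ ()) (λ v → ⊥-elim (noVertex v)) (λ v → ⊥-elim (noVertex v)) (λ ())
  ; isHom  = λ () }

_⊕_ : Graph → Graph → Graph
G₁ ⊕ G₂ = record { V = V G₁ ⊎ V G₂ ; E = edge }
  where
  edge : V G₁ ⊎ V G₂ → V G₁ ⊎ V G₂ → Set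
  edge (inj₁ x) (inj₁ y) = E G₁ x y
  edge (inj₂ x) (inj₂ y) = E G₂ x y
  edge _        _        = ⊥

union : ∀ {G₁ G₂} → Tiling H G₁ → Tiling H G₂ → Tiling H (G₁ ⊕ G₂)
union {H} {G₁} {G₂} T₁ T₂ = record { copies = A.copies + B.copies ; place = place ; isHom = isHom }
  where
  module A = Tiling T₁
  module B = Tiling T₂
  place : (Fin (A.copies + B.copies) × V H) ↔ (V G₁ ⊎ V G₂)
  place = ⊎-cong A.place B.place
            ↔-∘ (×-distribʳ-⊎ 0ℓ (V H) (Fin A.copies) (Fin B.copies) ↔-∘ ×-cong +↔⊎ ↔-refl)
  isHom : ∀ i → IsHom H (G₁ ⊕ G₂) (λ x → to place (i , x))
  isHom i with splitAt A.copies i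
  ... | inj₁ j = A.isHom j
  ... | inj₂ j = B.isHom j

-- The relabellings of complete multipartite graphs below all keep the class
-- of every vertex, which is why they preserve edges.

fibrewise : {I : Set} {A B : I → Set} → (∀ i → A i ↔ B i) → Σ I A ↔ Σ I B
fibrewise f = mk↔ₛ′
  (λ (i , a) → i , to (f i) a)
  (λ (i , b) → i , from (f i) b)
  (λ (i , b) → cong (i ,_) (strictlyInverseˡ (f i) b))
  (λ (i , a) → cong (i ,_) (strictlyInverseʳ (f i) a))

mergeClasses : ∀ r (n₁ n₂ : Fin r → ℕ) →
  SpanningCopy (completeMultipartite r n₁ ⊕ completeMultipartite r n₂)
               (completeMultipartite r (λ c → n₁ c + n₂ c))
mergeClasses r n₁ n₂ = record { relabel = relabel ; keepsEdges = keepsEdges }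
  where
  G₁ = completeMultipartite r n₁
  G₂ = completeMultipartite r n₂
  relabel : V (G₁ ⊕ G₂) ↔ V (completeMultipartite r (λ c → n₁ c + n₂ c))
  relabel = fibrewise (λ c → ↔-sym +↔⊎) ↔-∘ ↔-sym Σ-distribˡ-⊎
  keepsEdges : IsHom (G₁ ⊕ G₂) (completeMultipartite r (λ c → n₁ c + n₂ c)) (to relabel)
  keepsEdges (inj₁ _) (inj₁ _) e = e
  keepsEdges (inj₂ _) (inj₂ _) e = e

resize : ∀ r {n n' : Fin r → ℕ} → (∀ c → n c ≡ n' c) →
  SpanningCopy (completeMultipartite r n) (completeMultipartite r n')
resize r eq = record
  { relabel    = fibrewise (λ c → subst (λ s → Fin _ ↔ Fin s) (eq c) ↔-refl)
  ; keepsEdges = λ _ _ e → e }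

repeatTiling : ∀ {r n} → Tiling H (completeMultipartite r n) →
  ∀ s → Tiling H (completeMultipartite r (λ c → s * n c))
repeatTiling T zero    = emptyTiling (λ { (_ , ()) })
repeatTiling T (suc s) = retile (union T (repeatTiling T s)) (mergeClasses _ _ _)

blowUpClasses : ∀ r (sz : Fin r → ℕ) t →
  V (blowUp (completeMultipartite r sz) t) ↔ V (completeMultipartite r (λ c → sz c * t))
blowUpClasses r sz t = fibrewise (λ c → ↔-sym *↔×) ↔-∘ Σ-assoc

blowUpAsMultipartite : ∀ r (sz : Fin r → ℕ) t →
  SpanningCopy (blowUp (completeMultipartite r sz) t) (completeMultipartite r (λ c → sz c * t))
blowUpAsMultipartite r sz t = record { relabel = blowUpClasses r sz t ; keepsEdges = λ _ _ e → e }

multipartiteAsBlowUp : ∀ r (sz : Fin r → ℕ) t →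
  SpanningCopy (completeMultipartite r (λ c → sz c * t)) (blowUp (completeMultipartite r sz) t)
multipartiteAsBlowUp r sz t = record { relabel = ↔-sym (blowUpClasses r sz t) ; keepsEdges = λ _ _ e → e }

blowUpTwice : ∀ F s t → SpanningCopy (blowUp (blowUp F s) t) (blowUp F (s * t))
blowUpTwice F s t = record
  { relabel    = ×-cong ↔-refl (↔-sym *↔×) ↔-∘ Σ-assoc
  ; keepsEdges = λ _ _ e → e }

-- Addition and subtraction modulo r on Fin r (the cyclic group Z/rZ), used
-- as the Latin square that rotates colour classes.
module Cyclic (r : ℕ) .{{_ : NonZero r}} where

  _+ₘ_ : Fin r → Fin r → Fin r
  i +ₘ c = (toℕ i + toℕ c) mod r

  _-ₘ_ : Fin r → Fin r → Fin r
  i -ₘ c = (toℕ i + (r ∸ toℕ c)) mod r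

  %-absorbˡ : ∀ x y → (x % r + y) % r ≡ (x + y) % r
  %-absorbˡ x y = begin
    (x % r + y) % r             ≡⟨ %-distribˡ-+ (x % r) y r ⟩
    (x % r % r + y % r) % r     ≡⟨ cong (λ z → (z + y % r) % r) (m%n%n≡m%n x r) ⟩
    (x % r + y % r) % r         ≡⟨ %-distribˡ-+ x y r ⟨
    (x + y) % r                 ∎
    where open ≡-Reasoning

  shift-shift : ∀ (i : Fin r) a b → a + b ≡ r → toℕ ((toℕ ((toℕ i + a) mod r) + b) mod r) ≡ toℕ i
  shift-shift i a b a+b≡r = begin
    toℕ ((toℕ ((toℕ i + a) mod r) + b) mod r) ≡⟨ toℕ-fromℕ< (m%n<n _ r) ⟩
    (toℕ ((toℕ i + a) mod r) + b) % r         ≡⟨ cong (λ z → (z + b) % r) (toℕ-fromℕ< (m%n<n _ r)) ⟩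
    ((toℕ i + a) % r + b) % r                 ≡⟨ %-absorbˡ (toℕ i + a) b ⟩
    (toℕ i + a + b) % r                       ≡⟨ cong (_% r) (trans (+-assoc (toℕ i) a b) (cong (toℕ i +_) a+b≡r)) ⟩
    (toℕ i + r) % r                           ≡⟨ [m+n]%n≡m%n (toℕ i) r ⟩
    toℕ i % r                                 ≡⟨ m<n⇒m%n≡m (toℕ<n i) ⟩
    toℕ i                                     ∎
    where open ≡-Reasoning

  +ₘ-ₘ : ∀ i c → (i +ₘ c) -ₘ c ≡ i
  +ₘ-ₘ i c = toℕ-injective (shift-shift i (toℕ c) (r ∸ toℕ c) (m+[n∸m]≡n (<⇒≤ (toℕ<n c))))

  -ₘ+ₘ : ∀ j c → (j -ₘ c) +ₘ c ≡ j
  -ₘ+ₘ j c = toℕ-injective (shift-shift j (r ∸ toℕ c) (toℕ c) (m∸n+n≡m (<⇒≤ (toℕ<n c))))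

  +ₘ-comm : ∀ i c → i +ₘ c ≡ c +ₘ i
  +ₘ-comm i c = cong (_mod r) (+-comm (toℕ i) (toℕ c))

  +ₘ-cancelˡ : ∀ i {c c'} → i +ₘ c ≡ i +ₘ c' → c ≡ c'
  +ₘ-cancelˡ i {c} {c'} eq = begin
    c               ≡⟨ +ₘ-ₘ c i ⟨
    (c +ₘ i) -ₘ i   ≡⟨ cong (_-ₘ i) (trans (+ₘ-comm c i) (trans eq (+ₘ-comm i c'))) ⟩
    (c' +ₘ i) -ₘ i  ≡⟨ +ₘ-ₘ c' i ⟩
    c'              ∎
    where open ≡-Reasoning

-- A graph on N vertices with a proper r-colouring tiles the balanced complete
-- r-partite graph K_r(N): copy i puts vertex x into class (i + colour x)
-- mod r, at the position given by an enumeration of V H.  Each class of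
-- K_r(N) receives every vertex of H exactly once over the r copies.
rotationTiling : ∀ r .{{_ : NonZero r}} {N} (colour : V H → Fin r) →
  (∀ x y → E H x y → colour x ≢ colour y) → V H ↔ Fin N →
  Tiling H (completeMultipartite r (λ _ → N))
rotationTiling {H} r {N} colour proper enum = record
  { copies = r
  ; place  = mk↔ₛ′ rotate unrotate rotate-unrotate unrotate-rotate
  ; isHom  = λ i x y e same → proper x y e (+ₘ-cancelˡ i same) }
  where
  open Cyclic r
  rotate : Fin r × V H → Fin r × Fin N
  rotate (i , x) = i +ₘ colour x , to enum x
  unrotate : Fin r × Fin N → Fin r × V H
  unrotate (j , p) = j -ₘ colour (from enum p) , from enum p
  rotate-unrotate : ∀ v → rotate (unrotate v) ≡ v
  rotate-unrotate (j , p) rewrite strictlyInverseˡ enum p = cong (_, p) (-ₘ+ₘ j (colour (from enum p)))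
  unrotate-rotate : ∀ u → unrotate (rotate u) ≡ u
  unrotate-rotate (i , x) rewrite strictlyInverseʳ enum x = cong (_, x) (+ₘ-ₘ i (colour x))

bottleEnumeration : ∀ n σ ω → V (bottle (suc n) σ ω) ↔ Fin (bottleOrder (suc n) σ ω)
bottleEnumeration n σ ω = ↔-sym +↔⊎ ↔-∘ (⊎-cong ↔-refl (↔-sym *↔×) ↔-∘ neckOrWide)
  where
  neckOrWide : V (bottle (suc n) σ ω) ↔ (Fin σ ⊎ (Fin n × Fin ω))
  neckOrWide = mk↔ₛ′
    (λ { (zero , a) → inj₁ a ; (suc c , a) → inj₂ (c , a) })
    (λ { (inj₁ a) → zero , a ; (inj₂ (c , a)) → suc c , a })
    (λ { (inj₁ _) → refl ; (inj₂ _) → refl })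
    (λ { (zero , _) → refl ; (suc _ , _) → refl })

blowUpEnumeration : ∀ F {N} m → V F ↔ Fin N → V (blowUp F m) ↔ Fin (N * m)
blowUpEnumeration F m enum = ↔-sym *↔× ↔-∘ ×-cong enum ↔-refl

gap : ∀ σ d → suc (σ + d) ∸ σ ≡ suc d
gap σ d = trans (cong (_∸ σ) (sym (+-suc σ d))) (m+n∸m≡n σ (suc d))

-- Class sizes of B'(mt) (neck σ, width ω - 1 = σ + d, t = (ω - σ) b): they
-- are those of (d b) copies of B* plus σ copies of K_r(b m).
narrowBottleSizes : ∀ {r} σ d b m (c : Fin r) →
  d * b * (bottleSizes r σ (suc (σ + d)) c * m) + σ * (b * m)
    ≡ bottleSizes r σ (σ + d) c * (m * ((suc (σ + d) ∸ σ) * b))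
narrowBottleSizes σ d b m zero    rewrite gap σ d = neck d b σ m
  where
  neck : ∀ d b σ m → d * b * (σ * m) + σ * (b * m) ≡ σ * (m * (suc d * b))
  neck = solve-∀
narrowBottleSizes σ d b m (suc _) rewrite gap σ d = width d b σ m
  where
  width : ∀ d b σ m → d * b * (suc (σ + d) * m) + σ * (b * m) ≡ (σ + d) * (m * (suc d * b))
  width = solve-∀

-- Class sizes of K_r(mt) with t = w b: those of w copies of K_r(b m).
balancedSizes : ∀ w b m → w * (b * m) ≡ m * (w * b)
balancedSizes = solve-∀

lemma6p2 : (r m σ ω : ℕ) → 1 ≤ r → 1 ≤ σ → σ < ω →
    let B  = bottle r σ ω
        b  = bottleOrder r σ ω
        B' = bottle r σ (ω ∸ 1)
        B* = blowUp B m
        t  = (ω ∸ σ) * b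
    in HasPerfectTiling B* (blowUp B (m * t))
     × HasPerfectTiling B* (blowUp B* (m * t))
     × HasPerfectTiling B* (blowUp B' (m * t))
     × HasPerfectTiling B* (blowUp (K r) (m * t))
-- Each of the four tilings is assembled from the layer tilings, the copy of
-- B* as itself and its rotations, summed class by class.
lemma6p2 (suc n) m σ ω _ _ σ<ω with m≤n⇒∃[o]m+o≡n σ<ω
... | d , refl =
    perfect (retile (layerTiling B* t) (blowUpTwice B m t))
  , perfect (layerTiling B* (m * t))
  , perfect (retile narrowed (multipartiteAsBlowUp r (bottleSizes r σ (σ + d)) (m * t)))
  , perfect (retile (repeatTiling rotated (ω' ∸ σ)) (resize r λ _ → balancedSizes (ω' ∸ σ) b m))
  where
  r : ℕ
  r = suc n
  ω' : ℕ
  ω' = suc (σ + d)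
  B B* : Graph
  B = bottle r σ ω'
  B* = blowUp B m
  b t : ℕ
  b = bottleOrder r σ ω'
  t = (ω' ∸ σ) * b
  asItself : Tiling B* (completeMultipartite r (λ c → bottleSizes r σ ω' c * m))
  asItself = singleTiling (blowUpAsMultipartite r (bottleSizes r σ ω') m)
  rotated : Tiling B* (completeMultipartite r (λ _ → b * m))
  rotated = rotationTiling r (λ v → proj₁ (proj₁ v)) (λ _ _ e → e)
              (blowUpEnumeration B m (bottleEnumeration n σ ω'))
  narrowed : Tiling B* (completeMultipartite r (λ c → bottleSizes r σ (σ + d) c * (m * t)))
  narrowed = retile (retile (union (repeatTiling asItself (d * b)) (repeatTiling rotated σ))
                            (mergeClasses r _ _))
                    (resize r (narrowBottleSizes σ d b m))
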